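{- Let $m\geq 3$ and $n\geq 2$ be integers and $G=K_m\square P_n$, with vertices $v_{i,j}$ ($1\le i\le m$, $1\le j\le n$), where $v_{i,j}$ and $v_{i',j'}$ are adjacent iff ($j=j'$ and $i\neq i'$) or ($i=i'$ and $|j-j'|=1$). Suppose there exists a locating $(m+1)$-coloring of $G$ with colors $\{1,\dots,m+1\}$, and let $C$ be its coloring matrix, i.e. the $m\times n$ matrix whose $(i,j)$-entry is the color of $v_{i,j}$. Then every two consecutive columns of $C$ have different missing colors. Moreover, if $m\geq 5$, then every two distinct columns of $C$ have different missing colors.
   Context: $K_m$ is the complete graph on $m$ vertices, $P_n$ the path on $n$ vertices, and $\square$ the cartesian product. Since each column of $C$ induces a clique $K_m$, its $m$ entries are distinct colors from $\{1,\dots,m+1\}$; the missing color of a column is the unique color of $\{1,\dots,m+1\}$ not appearing in it. For a connected graph, with $d$ the shortest-path distance and $d(v,S)=\min_{x\in S}d(v,x)$, a proper $k$-coloring (onto $\{1,\dots,k\}$) with color classes $(V_1,\dots,V_k)$ is locating if distinct vertices $v$ have distinct color codes $(d(v,V_1),\dots,d(v,V_k))$. -}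

module Defs where

open import Data.Nat using (ℕ; zero; suc; _≤_)
open import Data.Fin using (Fin; toℕ)
open import Data.Product using (Σ; ∃; _×_; _,_)
open import Data.Sum using (_⊎_)
open import Relation.Binary.PropositionalEquality using (_≡_; _≢_)
open import Relation.Nullary using (¬_)
open import Function.Bundles using (_⇔_)

-- Vertex v_{i,j} of K_m □ P_n is (i , j) with i : Fin m (row), j : Fin n (column).
Vertex : ℕ → ℕ → Set
Vertex m n = Fin m × Fin n

Adj : {m n : ℕ} → Vertex m n → Vertex m n → Set
Adj (i , j) (i' , j') =
  (j ≡ j' × i ≢ i') ⊎ (i ≡ i' × (suc (toℕ j) ≡ toℕ j' ⊎ suc (toℕ j') ≡ toℕ j))

data Walk {m n : ℕ} : Vertex m n → Vertex m n → ℕ → Set where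
  here : ∀ {u} → Walk u u zero
  step : ∀ {u w v k} → Adj u w → Walk w v k → Walk u v (suc k)

DistToSet : {m n : ℕ} → Vertex m n → (Vertex m n → Set) → ℕ → Set
DistToSet u P k =
  (∃ λ x → P x × Walk u x k) × (∀ x l → P x → Walk u x l → k ≤ l)

ColorClass : {m n k : ℕ} → (Vertex m n → Fin k) → Fin k → Vertex m n → Set
ColorClass c t v = c v ≡ t

Proper : {m n k : ℕ} → (Vertex m n → Fin k) → Set
Proper c = ∀ u v → Adj u v → c u ≢ c v

Onto : {m n k : ℕ} → (Vertex m n → Fin k) → Set
Onto c = ∀ t → ∃ λ v → c v ≡ t

SameCode : {m n k : ℕ} → (Vertex m n → Fin k) → Vertex m n → Vertex m n → Set
SameCode c u v = ∀ t d → DistToSet u (ColorClass c t) d ⇔ DistToSet v (ColorClass c t) d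

LocatingColoring : {m n k : ℕ} → (Vertex m n → Fin k) → Set
LocatingColoring c = Proper c × Onto c × (∀ u v → SameCode c u v → u ≡ v)

-- t is a missing color of column j (the coloring matrix entry C_{i,j} = c (i , j)).
MissingColor : {m n k : ℕ} → (Vertex m n → Fin k) → Fin n → Fin k → Set
MissingColor {m} c j t = ∀ (i : Fin m) → c (i , j) ≢ t

-- A column missing color t contains every other color, so two equally colored
-- vertices in two such columns are at distance 0 or 1 from every color class but
-- V_t, and a locating coloring must separate them by their distance to V_t.
-- For adjacent columns a, b let K be the least column distance from a or b to a
-- vertex of color t. Properness leaves at most one row of each column at distance
-- K from V_t, and when there is one the other rows are at distance K + 1. If both
-- columns have such a row, a color other than t and the colors of these two rows
-- (m ≥ 3) gives two equally colored vertices at distance K + 1; if only a has one,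
-- say in row p, then (p , b) and the vertex of a with the color of (p , b) are.
-- For arbitrary columns j, j′ the first part puts a t in every column adjacent to
-- one missing t, so every row of j is at distance 2 from V_t except the at most two
-- rows facing those t's; for m ≥ 5 some color avoids t and the four exceptions.
module Submission where

open import Defs
open import Data.Nat using (ℕ; zero; suc; pred; _+_; _≤_; _<_; ∣_-_∣; z≤n; s≤s)
open import Data.Nat.Properties
  using (≤-trans; ≤-reflexive; ≤-antisym; <⇒≤; <⇒≱; ≮⇒≥; ≤∧≢⇒<; 1+n≰n; m≤n⇒m≤1+n; m≤m+n;
         +-suc; +-identityʳ; +-cancelʳ-≡; +-mono-≤; m+[n∸m]≡n; ≤-total; suc-injective;
         ∣n-n∣≡0; ∣m-n∣≡0⇒m≡n; ∣m-m+n∣≡n; ∣-∣-comm; ∣-∣-triangle; m≤n⇒∣m-n∣≡n∸m; m≤n⇒∣n-m∣≡n∸m)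
  renaming (_≟_ to _≟ℕ_)
open import Data.Nat.Induction using (<-rec)
open import Data.Fin as Fin using (Fin; toℕ; fromℕ<; zero; suc)
open import Data.Fin.Properties using (toℕ-injective; toℕ-fromℕ<; toℕ<n; any?; all?; ¬∀⟶∃¬; injective⇒≤; _≟_)
open import Data.Product using (_×_; _,_; proj₁; proj₂; ∃; ∃₂; map₂)
open import Data.Vec.Functional using ([]; _∷_)
open import Data.Sum as Sum using (_⊎_; inj₁; inj₂; [_,_]; swap)
open import Data.Empty using (⊥; ⊥-elim)
open import Function using (_∘_)
open import Function.Bundles using (mk⇔)
open import Function.Definitions using (Injective)
open import Relation.Binary.PropositionalEquality using (_≡_; _≢_; refl; sym; trans; cong; subst)
open import Relation.Nullary using (¬_; Dec; yes; no; contradiction)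
open import Relation.Nullary.Decidable using (¬?; decidable-stable; _×-dec_; _⊎-dec_)
open import Relation.Unary using (Decidable)

∣m-n∣≡k⇒m+k≡n⊎n+k≡m : ∀ m n {k} → ∣ m - n ∣ ≡ k → m + k ≡ n ⊎ n + k ≡ m
∣m-n∣≡k⇒m+k≡n⊎n+k≡m zero    n       e = inj₁ (sym e)
∣m-n∣≡k⇒m+k≡n⊎n+k≡m (suc m) zero    e = inj₂ (sym e)
∣m-n∣≡k⇒m+k≡n⊎n+k≡m (suc m) (suc n) e =
  Sum.map (cong suc) (cong suc) (∣m-n∣≡k⇒m+k≡n⊎n+k≡m m n e)

∣n-1+n∣≡1 : ∀ n → ∣ n - suc n ∣ ≡ 1
∣n-1+n∣≡1 zero    = refl
∣n-1+n∣≡1 (suc n) = ∣n-1+n∣≡1 n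

far-side-left : ∀ {a x k} → ∣ a - x ∣ ≡ k → k ≤ ∣ suc a - x ∣ → x + k ≡ a
far-side-left {a} {x} {zero}   d _ = trans (+-identityʳ x) (sym (∣m-n∣≡0⇒m≡n d))
far-side-left {a} {x} {suc k} d k≤ with ∣m-n∣≡k⇒m+k≡n⊎n+k≡m a x d
... | inj₂ e    = e
... | inj₁ refl =
  contradiction (subst (suc k ≤_) (trans (cong (λ y → ∣ suc a - y ∣) (+-suc a k)) (∣m-m+n∣≡n a k)) k≤) 1+n≰n

far-side-right : ∀ {b x k} → ∣ suc b - x ∣ ≡ k → k ≤ ∣ b - x ∣ → suc b + k ≡ x
far-side-right {b} {x} {zero}  d _ = trans (+-identityʳ (suc b)) (∣m-n∣≡0⇒m≡n d)
far-side-right {b} {x} {suc k} d k≤ with ∣m-n∣≡k⇒m+k≡n⊎n+k≡m (suc b) x d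
... | inj₁ e = e
... | inj₂ e = contradiction (subst (suc k ≤_) ∣b-x∣≡k k≤) 1+n≰n
  where
  ∣b-x∣≡k : ∣ b - x ∣ ≡ k
  ∣b-x∣≡k = trans (cong (∣_- x ∣) (suc-injective (trans (sym e) (+-suc x k))))
                  (trans (∣-∣-comm (x + k) x) (∣m-m+n∣≡n x k))

far-side-unique : ∀ {a b x y k} → suc a ≡ b ⊎ suc b ≡ a →
  ∣ a - x ∣ ≡ k → ∣ a - y ∣ ≡ k → k ≤ ∣ b - x ∣ → k ≤ ∣ b - y ∣ → x ≡ y
far-side-unique (inj₁ refl) dx dy bx by =
  +-cancelʳ-≡ _ _ _ (trans (far-side-left dx bx) (sym (far-side-left dy by)))
far-side-unique (inj₂ refl) dx dy bx by = trans (sym (far-side-right dx bx)) (far-side-right dy by)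

Minimum : (ℕ → Set) → ℕ → Set
Minimum Q k = Q k × (∀ {k′} → Q k′ → k ≤ k′)

least-number : ∀ {Q : ℕ → Set} → Decidable Q → ∀ {k} → Q k → ∃ (Minimum Q)
least-number {Q} Q? {k} = <-rec (λ k → Q k → ∃ (Minimum Q)) go k
  where
  go : ∀ k → (∀ {k′} → k′ < k → Q k′ → ∃ (Minimum Q)) → Q k → ∃ (Minimum Q)
  go k smaller qk with any? {n = k} (Q? ∘ toℕ)
  ... | yes (i , qi) = smaller (toℕ<n i) qi
  ... | no none      = k , qk , λ {k′} qk′ →
    ≮⇒≥ (λ k′<k → none (fromℕ< k′<k , subst Q (sym (toℕ-fromℕ< k′<k)) qk′))

∃-notInImage : ∀ {k N} → k < N → (v : Fin k → Fin N) → ∃ λ a → ∀ i → v i ≢ a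
∃-notInImage {k} {N} k<N v with any? {n = N} (λ a → all? (λ i → ¬? (v i ≟ a)))
... | yes avoided = avoided
... | no none     = contradiction (injective⇒≤ preimage-injective) (<⇒≱ k<N)
  where
  preimage : ∀ a → ∃ λ i → v i ≡ a
  preimage a = map₂ (λ {i} → decidable-stable (v i ≟ a))
                    (¬∀⟶∃¬ k _ (λ i → ¬? (v i ≟ a)) (λ avoids → none (a , avoids)))
  preimage-injective : Injective _≡_ _≡_ (proj₁ ∘ preimage)
  preimage-injective {a} {b} e =
    trans (sym (proj₂ (preimage a))) (trans (cong v e) (proj₂ (preimage b)))

injection-covers : ∀ {m} {f : Fin m → Fin (suc m)} → Injective _≡_ _≡_ f →
  ∀ {t} → (∀ i → f i ≢ t) → ∀ {a} → a ≢ t → ∃ λ i → f i ≡ a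
injection-covers {m} {f} f-inj {t} misses {a} a≢t with any? (λ i → f i ≟ a)
... | yes hit  = hit
... | no ¬hit = contradiction (injective⇒≤ F-injective) 1+n≰n
  where
  F : Fin (suc (suc m)) → Fin (suc m)
  F zero          = t
  F (suc zero)    = a
  F (suc (suc i)) = f i
  F-injective : Injective _≡_ _≡_ F
  F-injective {zero}          {zero}           _ = refl
  F-injective {zero}          {suc zero}       e = contradiction (sym e) a≢t
  F-injective {zero}          {suc (suc i)}    e = contradiction (sym e) (misses i)
  F-injective {suc zero}      {zero}           e = contradiction e a≢t
  F-injective {suc zero}      {suc zero}       _ = refl
  F-injective {suc zero}      {suc (suc i)}    e = contradiction (i , sym e) ¬hit
  F-injective {suc (suc i)}   {zero}           e = contradiction e (misses i)
  F-injective {suc (suc i)}   {suc zero}       e = contradiction (i , e) ¬hit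
  F-injective {suc (suc i)}   {suc (suc i′)}   e = cong (Fin.suc ∘ Fin.suc) (f-inj e)

module _ {n : ℕ} where

  ColAdj : Fin n → Fin n → Set
  ColAdj j l = suc (toℕ j) ≡ toℕ l ⊎ suc (toℕ l) ≡ toℕ j

  colDist : Fin n → Fin n → ℕ
  colDist j l = ∣ toℕ j - toℕ l ∣

  colDist-ColAdj : ∀ {j l} → ColAdj j l → colDist j l ≡ 1
  colDist-ColAdj {j} {l} (inj₁ e) = trans (cong (∣ toℕ j -_∣) (sym e)) (∣n-1+n∣≡1 (toℕ j))
  colDist-ColAdj {j} {l} (inj₂ e) =
    trans (cong (∣_- toℕ l ∣) (sym e)) (trans (∣-∣-comm (suc (toℕ l)) (toℕ l)) (∣n-1+n∣≡1 (toℕ l)))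

  ColAdj⇒≢ : ∀ {j l} → ColAdj j l → j ≢ l
  ColAdj⇒≢ {j} adj refl = contradiction (trans (sym (∣n-n∣≡0 (toℕ j))) (colDist-ColAdj adj)) λ ()

  adjacent-column : 2 ≤ n → (j : Fin n) → ∃ λ l → ColAdj j l
  adjacent-column 2≤n j with toℕ j in e
  ... | zero  = fromℕ< 2≤n , inj₁ (sym (toℕ-fromℕ< 2≤n))
  ... | suc k = fromℕ< k<n , inj₂ (cong suc (toℕ-fromℕ< k<n))
    where
    k<n : k < n
    k<n = <⇒≤ (subst (_< n) e (toℕ<n j))

module _ {m n : ℕ} where

  Adj-sym : {u v : Vertex m n} → Adj u v → Adj v u
  Adj-sym (inj₁ (refl , i≢i′)) = inj₁ (refl , i≢i′ ∘ sym)
  Adj-sym (inj₂ (refl , adj))  = inj₂ (refl , swap adj)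

  _▹_ : {u v w : Vertex m n} {k : ℕ} → Walk u v k → Adj v w → Walk u w (suc k)
  here       ▹ a = step a here
  step a′ p  ▹ a = step a′ (p ▹ a)

  reverse : {u v : Vertex m n} {k : ℕ} → Walk u v k → Walk v u k
  reverse here       = here
  reverse (step a p) = reverse p ▹ Adj-sym a

  rightward-walk : ∀ k (i : Fin m) {j l : Fin n} → toℕ j + k ≡ toℕ l → Walk (i , j) (i , l) k
  rightward-walk zero    i {j} e with toℕ-injective (trans (sym (+-identityʳ (toℕ j))) e)
  ... | refl = here
  rightward-walk (suc k) i {j} {l} e =
    step (inj₂ (refl , inj₁ (sym (toℕ-fromℕ< j+1<n)))) (rightward-walk k i e′)
    where
    j+1≤l : suc (toℕ j) ≤ toℕ l
    j+1≤l = subst (suc (toℕ j) ≤_) (trans (sym (+-suc (toℕ j) k)) e) (s≤s (m≤m+n (toℕ j) k))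
    j+1<n : suc (toℕ j) < n
    j+1<n = ≤-trans (s≤s j+1≤l) (toℕ<n l)
    e′ : toℕ (fromℕ< j+1<n) + k ≡ toℕ l
    e′ = trans (cong (_+ k) (toℕ-fromℕ< j+1<n)) (trans (sym (+-suc (toℕ j) k)) e)

  walk-along-row : (i : Fin m) (j l : Fin n) → Walk (i , j) (i , l) (colDist j l)
  walk-along-row i j l with ≤-total (toℕ j) (toℕ l)
  ... | inj₁ j≤l = subst (Walk _ _) (sym (m≤n⇒∣m-n∣≡n∸m j≤l)) (rightward-walk _ i (m+[n∸m]≡n j≤l))
  ... | inj₂ l≤j = subst (Walk _ _) (sym (m≤n⇒∣n-m∣≡n∸m l≤j)) (reverse (rightward-walk _ i (m+[n∸m]≡n l≤j)))

  walk-length-≥ : ∀ {i r : Fin m} {j l : Fin n} {w} → Walk (i , j) (r , l) w → colDist j l ≤ w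
  walk-length-≥ {j = j} here = ≤-reflexive (∣n-n∣≡0 (toℕ j))
  walk-length-≥ (step (inj₁ (refl , _)) p) = m≤n⇒m≤1+n (walk-length-≥ p)
  walk-length-≥ {j = j} {l} (step {w = _ , j′} (inj₂ (refl , adj)) p) =
    ≤-trans (∣-∣-triangle (toℕ j) (toℕ j′) (toℕ l))
            (+-mono-≤ (≤-reflexive (colDist-ColAdj adj)) (walk-length-≥ p))

  walk-length-> : ∀ {i r : Fin m} {j l : Fin n} {w} → Walk (i , j) (r , l) w → i ≢ r → colDist j l < w
  walk-length-> here i≢r = contradiction refl i≢r
  walk-length-> (step (inj₁ (refl , _)) p) _ = s≤s (walk-length-≥ p)
  walk-length-> {j = j} {l} (step {w = _ , j′} (inj₂ (refl , adj)) p) i≢r =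
    s≤s (≤-trans (∣-∣-triangle (toℕ j) (toℕ j′) (toℕ l))
                 (≤-trans (≤-reflexive (cong (_+ colDist j′ l) (colDist-ColAdj adj))) (walk-length-> p i≢r)))

  DistToSet-unique : ∀ {u : Vertex m n} {P d d′} → DistToSet u P d → DistToSet u P d′ → d ≡ d′
  DistToSet-unique ((x , px , wx) , least) ((y , py , wy) , least′) =
    ≤-antisym (least y _ py wy) (least′ x _ px wx)

  sameCode-from-common : ∀ {k} {c : Vertex m n → Fin k} {x y} →
    (∀ s → ∃ λ d → DistToSet x (ColorClass c s) d × DistToSet y (ColorClass c s) d) → SameCode c x y
  sameCode-from-common {x = x} {y} common s d with common s
  ... | e , Dx , Dy = mk⇔ (λ D → subst (DistToSet y _) (DistToSet-unique Dx D) Dy)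
                          (λ D → subst (DistToSet x _) (DistToSet-unique Dy D) Dx)

module _ {m n : ℕ} {c : Vertex m n → Fin (suc m)} (proper : Proper c) where

  private
    V : Fin (suc m) → Vertex m n → Set
    V = ColorClass c

  column-injective : ∀ {i i′ j} → c (i , j) ≡ c (i′ , j) → i ≡ i′
  column-injective {i} {i′} e = decidable-stable (i ≟ i′) (λ i≢i′ → proper _ _ (inj₁ (refl , i≢i′)) e)

  column-injective-toℕ : ∀ {i i′ j j′} → toℕ j ≡ toℕ j′ → c (i , j) ≡ c (i′ , j′) → i ≡ i′
  column-injective-toℕ e with toℕ-injective e
  ... | refl = column-injective

  column-covers : ∀ {j t} → MissingColor c j t → ∀ {a} → a ≢ t → ∃ λ i → c (i , j) ≡ a
  column-covers missing = injection-covers column-injective missing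

  dist-own-color : ∀ v → DistToSet v (V (c v)) 0
  dist-own-color v = (v , refl , here) , λ _ _ _ _ → z≤n

  dist-column-color : ∀ {i j t s} → MissingColor c j t → s ≢ t → s ≢ c (i , j) → DistToSet (i , j) (V s) 1
  dist-column-color {i} {j} {s = s} missing s≢t s≢cij with column-covers missing s≢t
  ... | r , crj = ((r , j) , crj , step (inj₁ (refl , i≢r)) here) , positive
    where
    i≢r : i ≢ r
    i≢r refl = s≢cij (sym crj)
    positive : ∀ z w → V s z → Walk (i , j) z w → 1 ≤ w
    positive _ zero    cz here = contradiction (sym cz) s≢cij
    positive _ (suc _) _  _    = s≤s z≤n

  sameCode-of-missing : ∀ {i i′ j j′ t d} → MissingColor c j t → MissingColor c j′ t →
    c (i , j) ≡ c (i′ , j′) → DistToSet (i , j) (V t) d → DistToSet (i′ , j′) (V t) d →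
    SameCode c (i , j) (i′ , j′)
  sameCode-of-missing {i} {i′} {j} {j′} {t} {d} mj mj′ e Dx Dy = sameCode-from-common common
    where
    common : ∀ s → ∃ λ d → DistToSet (i , j) (V s) d × DistToSet (i′ , j′) (V s) d
    common s with s ≟ c (i , j) | s ≟ t
    ... | yes refl | _        = 0 , dist-own-color _ , subst (λ s → DistToSet _ (V s) 0) (sym e) (dist-own-color _)
    ... | no _     | yes refl = d , Dx , Dy
    ... | no s≢x   | no s≢t   = 1 , dist-column-color mj s≢t s≢x , dist-column-color mj′ s≢t (s≢x ∘ (λ q → trans q (sym e)))

  -- The color of column j in the row where the column of index L has color t;
  -- t itself when there is no such row.
  color-beside : ∀ t (j : Fin n) (L : ℕ) → ∃ λ f → ∀ {r l} → toℕ l ≡ L → c (r , l) ≡ t → c (r , j) ≡ f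
  color-beside t j L with any? (λ r → any? λ l → (toℕ l ≟ℕ L) ×-dec (c (r , l) ≟ t))
  ... | yes (r₀ , l₀ , e₀ , ct₀) =
    c (r₀ , j) , λ e ct → cong (λ r → c (r , j)) (column-injective-toℕ (trans e (sym e₀)) (trans ct (sym ct₀)))
  ... | no none = t , λ e ct → ⊥-elim (none (_ , _ , e , ct))

  shadow : Fin (suc m) → Fin n → ℕ → Fin (suc m)
  shadow t j L = proj₁ (color-beside t j L)

  ColorInRowAt : Fin (suc m) → Fin n → ℕ → Fin m → Set
  ColorInRowAt t a K i = ∃ λ l → c (i , l) ≡ t × colDist a l ≡ K

  colorInRowAt? : ∀ t a K → Dec (∃ (ColorInRowAt t a K))
  colorInRowAt? t a K = any? λ i → any? λ l → (c (i , l) ≟ t) ×-dec (colDist a l ≟ℕ K)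

  ColorAtColDist : Fin (suc m) → Fin n → Fin n → ℕ → Set
  ColorAtColDist t a b k = ∃₂ λ r l → c (r , l) ≡ t × (colDist a l ≡ k ⊎ colDist b l ≡ k)

  colorAtColDist? : ∀ t a b → Decidable (ColorAtColDist t a b)
  colorAtColDist? t a b k = any? λ r → any? λ l → (c (r , l) ≟ t) ×-dec ((colDist a l ≟ℕ k) ⊎-dec (colDist b l ≟ℕ k))

  module Nearest {t : Fin (suc m)} {a b : Fin n} (ab : ColAdj a b) (K : ℕ)
         (K≤a : ∀ {r l} → c (r , l) ≡ t → K ≤ colDist a l)
         (K≤b : ∀ {r l} → c (r , l) ≡ t → K ≤ colDist b l) where

    Near : Fin m → Set
    Near = ColorInRowAt t a K

    near-unique : ∀ {i i′} → Near i → Near i′ → i ≡ i′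
    near-unique (l , ct , d) (l′ , ct′ , d′) =
      column-injective-toℕ (far-side-unique ab d d′ (K≤b ct) (K≤b ct′)) (trans ct (sym ct′))

    walk-via-near : ∀ {p x} → Near p → Adj x (p , a) → ∃ λ z → V t z × Walk x z (suc K)
    walk-via-near {p} (l , ct , d) adj = (p , l) , ct , step adj (subst (Walk _ _) d (walk-along-row p a l))

    dist-not-near : ∀ {i} → ¬ Near i → (∃ λ z → V t z × Walk (i , a) z (suc K)) → DistToSet (i , a) (V t) (suc K)
    dist-not-near {i} ¬near reach = reach , beyond
      where
      beyond : ∀ z w → V t z → Walk (i , a) z w → suc K ≤ w
      beyond (r , l) w ct walk with i ≟ r
      ... | yes refl = ≤-trans (≤∧≢⇒< (K≤a ct) (λ d → ¬near (l , ct , sym d))) (walk-length-≥ walk)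
      ... | no i≢r   = ≤-trans (s≤s (K≤a ct)) (walk-length-> walk i≢r)

    dist-beside-near : ∀ {p i} → Near p → i ≢ p → DistToSet (i , a) (V t) (suc K)
    dist-beside-near p-near i≢p =
      dist-not-near (λ near → i≢p (near-unique near p-near)) (walk-via-near p-near (inj₁ (refl , i≢p)))

  module _ (separates : ∀ u v → SameCode c u v → u ≡ v) where

    no-equidistant-twins : ∀ {i i′ j j′ t d} → MissingColor c j t → MissingColor c j′ t → j ≢ j′ →
      c (i , j) ≡ c (i′ , j′) → DistToSet (i , j) (V t) d → DistToSet (i′ , j′) (V t) d → ⊥
    no-equidistant-twins mj mj′ j≢j′ e Dx Dy =
      j≢j′ (cong proj₂ (separates _ _ (sameCode-of-missing mj mj′ e Dx Dy)))

    module NearestPair (3≤m : 3 ≤ m) {t : Fin (suc m)} {a b : Fin n} (ab : ColAdj a b)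
           (ma : MissingColor c a t) (mb : MissingColor c b t) (K : ℕ)
           (K≤a : ∀ {r l} → c (r , l) ≡ t → K ≤ colDist a l)
           (K≤b : ∀ {r l} → c (r , l) ≡ t → K ≤ colDist b l) where
      private
        module A = Nearest ab K K≤a K≤b
        module B = Nearest (swap ab) K K≤b K≤a

      one-near : ∀ {p} → ColorInRowAt t a K p → (∀ q → ¬ ColorInRowAt t b K q) → ⊥
      one-near {p} p-near none-b with i , ci ← column-covers ma (mb p) =
        no-equidistant-twins ma mb (ColAdj⇒≢ ab) ci (A.dist-beside-near p-near i≢p)
          (B.dist-not-near (none-b p) (A.walk-via-near p-near (inj₂ (refl , swap ab))))
        where
        i≢p : i ≢ p
        i≢p refl = proper _ _ (inj₂ (refl , ab)) ci

      both-near : ∀ {p q} → ColorInRowAt t a K p → ColorInRowAt t b K q → ⊥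
      both-near {p} {q} p-near q-near
        with α , avoids ← ∃-notInImage (s≤s 3≤m) (t ∷ c (p , a) ∷ c (q , b) ∷ [])
        with i , ci ← column-covers ma (avoids zero ∘ sym)
        with i′ , ci′ ← column-covers mb (avoids zero ∘ sym) =
        no-equidistant-twins ma mb (ColAdj⇒≢ ab) (trans ci (sym ci′))
          (A.dist-beside-near p-near (λ { refl → avoids (suc zero) ci }))
          (B.dist-beside-near q-near (λ { refl → avoids (suc (suc zero)) ci′ }))

    nearest-pair-contradiction : 3 ≤ m → ∀ {t a b} → ColAdj a b →
      MissingColor c a t → MissingColor c b t → ∀ K →
      (∀ {r l} → c (r , l) ≡ t → K ≤ colDist a l) → (∀ {r l} → c (r , l) ≡ t → K ≤ colDist b l) →
      ∃ (ColorInRowAt t a K) ⊎ ∃ (ColorInRowAt t b K) → ⊥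
    nearest-pair-contradiction 3≤m {t} {a} {b} ab ma mb K K≤a K≤b some-near
      with colorInRowAt? t a K | colorInRowAt? t b K
    ... | yes (_ , p-near) | yes (_ , q-near) = NearestPair.both-near 3≤m ab ma mb K K≤a K≤b p-near q-near
    ... | yes (_ , p-near) | no none-b =
      NearestPair.one-near 3≤m ab ma mb K K≤a K≤b p-near (λ q q-near → none-b (q , q-near))
    ... | no none-a | yes (_ , q-near) =
      NearestPair.one-near 3≤m (swap ab) mb ma K K≤b K≤a q-near (λ p p-near → none-a (p , p-near))
    ... | no none-a | no none-b = [ none-a , none-b ] some-near

    module _ (onto : Onto c) (3≤m : 3 ≤ m) where

      adjacent-columns-not-both-missing : ∀ {a b t} → ColAdj a b → MissingColor c a t → MissingColor c b t → ⊥
      adjacent-columns-not-both-missing {a} {b} {t} ab ma mb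
        with (r₀ , l₀) , ct₀ ← onto t
        with K , (r , l , ct , a∨b) , K-least ← least-number (colorAtColDist? t a b) (r₀ , l₀ , ct₀ , inj₁ refl) =
        nearest-pair-contradiction 3≤m ab ma mb K
          (λ ct → K-least (_ , _ , ct , inj₁ refl)) (λ ct → K-least (_ , _ , ct , inj₂ refl))
          (Sum.map (λ d → r , l , ct , d) (λ d → r , l , ct , d) a∨b)

      color-in-adjacent-column : ∀ {j l t} → MissingColor c j t → ColAdj j l → ∃ λ r → c (r , l) ≡ t
      color-in-adjacent-column {l = l} {t} mj adj with any? (λ r → c (r , l) ≟ t)
      ... | yes found = found
      ... | no none   = ⊥-elim (adjacent-columns-not-both-missing adj mj (λ r ct → none (r , ct)))

      module _ (2≤n : 2 ≤ n) where

        dist-two : ∀ {i j t} → MissingColor c j t →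
          c (i , j) ≢ shadow t j (suc (toℕ j)) → c (i , j) ≢ shadow t j (pred (toℕ j)) →
          DistToSet (i , j) (V t) 2
        dist-two {i} {j} {t} mj right left
          with l , adj ← adjacent-column 2≤n j
          with r , ct ← color-in-adjacent-column mj adj =
          ((r , l) , ct , step (inj₁ (refl , not-beside adj ct ∘ sym)) (step (inj₂ (refl , adj)) here)) , beyond
          where
          not-beside : ∀ {r l} → ColAdj j l → c (r , l) ≡ t → r ≢ i
          not-beside (inj₁ e) ct refl = right (proj₂ (color-beside t j _) (sym e) ct)
          not-beside (inj₂ e) ct refl = left (proj₂ (color-beside t j _) (cong pred e) ct)
          beyond : ∀ z w → V t z → Walk (i , j) z w → 2 ≤ w
          beyond _        zero          ct here                                = ⊥-elim (mj i ct)
          beyond (r′ , _) (suc zero)    ct (step (inj₁ (refl , _)) here)      = ⊥-elim (mj r′ ct)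
          beyond _        (suc zero)    ct (step (inj₂ (refl , adj′)) here)   = ⊥-elim (not-beside adj′ ct refl)
          beyond _        (suc (suc _)) _  _                                  = s≤s (s≤s z≤n)

        distinct-columns-not-both-missing : 5 ≤ m → ∀ {j j′ t} → j ≢ j′ →
          MissingColor c j t → MissingColor c j′ t → ⊥
        distinct-columns-not-both-missing 5≤m {j} {j′} {t} j≢j′ mj mj′
          with α , avoids ← ∃-notInImage (s≤s 5≤m)
                 (t ∷ shadow t j (suc (toℕ j)) ∷ shadow t j (pred (toℕ j))
                    ∷ shadow t j′ (suc (toℕ j′)) ∷ shadow t j′ (pred (toℕ j′)) ∷ [])
          with i , ci ← column-covers mj (avoids zero ∘ sym)
          with i′ , ci′ ← column-covers mj′ (avoids zero ∘ sym) =
          no-equidistant-twins mj mj′ j≢j′ (trans ci (sym ci′))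
            (dist-two mj (λ e → avoids (suc zero) (trans (sym e) ci))
                         (λ e → avoids (suc (suc zero)) (trans (sym e) ci)))
            (dist-two mj′ (λ e → avoids (suc (suc (suc zero))) (trans (sym e) ci′))
                          (λ e → avoids (suc (suc (suc (suc zero)))) (trans (sym e) ci′)))

lemma1 : (m n : ℕ) → 3 ≤ m → 2 ≤ n →
    (c : Vertex m n → Fin (suc m)) → LocatingColoring c →
    (∀ (j j' : Fin n) → suc (toℕ j) ≡ toℕ j' → (t : Fin (suc m)) →
       ¬ (MissingColor c j t × MissingColor c j' t))
    × (5 ≤ m → ∀ (j j' : Fin n) → j ≢ j' → (t : Fin (suc m)) →
       ¬ (MissingColor c j t × MissingColor c j' t))
lemma1 m n 3≤m 2≤n c (proper , onto , separates) =
  (λ j j′ j+1≡j′ t (mj , mj′) →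
     adjacent-columns-not-both-missing proper separates onto 3≤m (inj₁ j+1≡j′) mj mj′) ,
  (λ 5≤m j j′ j≢j′ t (mj , mj′) →
     distinct-columns-not-both-missing proper separates onto 3≤m 2≤n 5≤m j≢j′ mj mj′)
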